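{- The Petersen graph confines each of the two-rooted graphs $T_1(1,0,2)$, $T_1(2,0,2)$, and $T_1(1,1,1)$.
   Context: Graphs are finite, simple and undirected. A two-rooted graph is a triple $(H,s,t)$ with $H$ a graph and $s,t\in V(H)$ not necessarily distinct. For $p,q,r\ge0$ with $p+q+r>0$, $F(p,q,r)$ is the path $(a_1,\dots,a_{p+q+r})$ together with pendant vertices $b_{p+1},\dots,b_{p+q}$, $b_{p+i}$ adjacent to $a_{p+i}$, and $T_1(p,q,r)=(F(p,q,r),a_1,a_p)$. (Thus $T_1(1,0,2)$ is a $3$-vertex path rooted twice at an endpoint; $T_1(2,0,2)$ is the path $(a_1,a_2,a_3,a_4)$ with roots $a_1,a_2$; $T_1(1,1,1)$ is the claw rooted twice at a leaf.) A copy of $(\hat H,\hat s,\hat t)$ in $G$ is $(H,s,t)$ with $H$ an induced subgraph of $G$ and an isomorphism $\hat H\to H$ mapping $\hat s\mapsto s$, $\hat t\mapsto t$. An extension of a copy $(H,s,t)$ in $G$ is $(H',s',t')$ with $H'$ an induced subgraph of $G$, $V(H')=V(H)\cup\{s',t'\}$, $s'\ne t'$ not in $V(H)$, $H'-\{s',t'\}=H$, and $s$ (resp. $t$) the unique neighbour of $s'$ (resp. $t'$) in $H'$; it is closable if there is an induced $s',t'$-path in $G$ all of whose internal vertices lie outside $N_G[V(H)]$. A copy is avoidable if all its extensions are closable. A graph $G$ confines $(\hat H,\hat s,\hat t)$ if $G$ contains an induced subgraph isomorphic to $\hat H$ but no avoidable copy of $(\hat H,\hat s,\hat t)$. -}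

module Defs where

open import Data.Nat using (ℕ; zero; suc; _+_; _∸_; _<_)
open import Data.Nat.Base using (_≡ᵇ_; _<ᵇ_; _≤ᵇ_)
open import Data.Fin using (Fin; toℕ; fromℕ; _↑ˡ_; _≟_)
import Data.Fin as Fin
open import Data.Bool using (Bool; true; false; _∧_; _∨_; not)
open import Data.Bool.Properties using (∨-comm)
open import Data.Product using (Σ; ∃; _×_; _,_)
open import Data.Sum using (_⊎_)
open import Relation.Nullary using (¬_; does; yes; no)
open import Relation.Binary.PropositionalEquality using (_≡_; _≢_; refl; sym; cong)

record Graph : Set where
  field
    n      : ℕ
    adj    : Fin n → Fin n → Bool
    adj-sym    : ∀ i j → adj i j ≡ adj j i
    adj-irrefl : ∀ i → adj i i ≡ false
open Graph public

private
  eqb : ∀ {n} → Fin n → Fin n → Bool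
  eqb i j = does (i ≟ j)

  eqb-sym : ∀ {n} (i j : Fin n) → eqb i j ≡ eqb j i
  eqb-sym i j with i ≟ j | j ≟ i
  ... | yes _ | yes _ = refl
  ... | no _  | no _  = refl
  ... | yes p | no q  with q (sym p)
  ... | ()
  eqb-sym i j | no q | yes p with q (sym p)
  ... | ()

  eqb-refl : ∀ {n} (i : Fin n) → eqb i i ≡ true
  eqb-refl i with i ≟ i
  ... | yes _ = refl
  ... | no q with q refl
  ... | ()

mkGraph : (n : ℕ) → (ℕ → ℕ → Bool) → Graph
mkGraph n e = record
  { n = n
  ; adj = λ i j → not (eqb i j) ∧ (e (toℕ i) (toℕ j) ∨ e (toℕ j) (toℕ i))
  ; adj-sym = λ i j → lemma i j
  ; adj-irrefl = λ i → irr i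
  }
  where
  lemma : ∀ (i j : Fin n) →
          not (eqb i j) ∧ (e (toℕ i) (toℕ j) ∨ e (toℕ j) (toℕ i))
          ≡ not (eqb j i) ∧ (e (toℕ j) (toℕ i) ∨ e (toℕ i) (toℕ j))
  lemma i j rewrite eqb-sym i j | ∨-comm (e (toℕ i) (toℕ j)) (e (toℕ j) (toℕ i)) = refl
  irr : ∀ (i : Fin n) → not (eqb i i) ∧ (e (toℕ i) (toℕ i) ∨ e (toℕ i) (toℕ i)) ≡ false
  irr i rewrite eqb-refl i = refl

-- The Petersen graph: outer 5-cycle 0-1-2-3-4-0, spokes i ~ i+5,
-- inner pentagram (i+5) ~ ((i+2) mod 5)+5.
petersenEdge : ℕ → ℕ → Bool
petersenEdge 0 1 = true
petersenEdge 1 2 = true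
petersenEdge 2 3 = true
petersenEdge 3 4 = true
petersenEdge 4 0 = true
petersenEdge 0 5 = true
petersenEdge 1 6 = true
petersenEdge 2 7 = true
petersenEdge 3 8 = true
petersenEdge 4 9 = true
petersenEdge 5 7 = true
petersenEdge 7 9 = true
petersenEdge 9 6 = true
petersenEdge 6 8 = true
petersenEdge 8 5 = true
petersenEdge _ _ = false

Petersen : Graph
Petersen = mkGraph 10 petersenEdge

-- F(p,q,r) with p = suc p'.  Vertex set Fin (suc p' + (q + r + q)):
-- index i < L := suc p' + q + r is a_{i+1}; index L + k (k < q) is b_{p+k+1},
-- adjacent to a_{p+k+1}, i.e. to index p + k.
FEdge : ℕ → ℕ → ℕ → ℕ → ℕ → Bool
FEdge p q r i j =
  ((suc i ≡ᵇ j) ∧ (j <ᵇ L)) ∨ ((L ≤ᵇ j) ∧ ((p + (j ∸ L)) ≡ᵇ i))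
  where L = p + q + r

F : ℕ → ℕ → ℕ → Graph
F p' q r = mkGraph (suc p' + (q + r + q)) (FEdge (suc p') q r)

record TwoRooted : Set where
  constructor ⟨_,_,_⟩
  field
    graph : Graph
    root₁ : Fin (n graph)
    root₂ : Fin (n graph)
open TwoRooted public

-- T₁(p'+1, q, r) = (F(p'+1,q,r), a₁, a_{p'+1}).
T₁ : ℕ → ℕ → ℕ → TwoRooted
T₁ p' q r = ⟨ F p' q r , (Fin.zero {p'} ↑ˡ (q + r + q)) , (fromℕ p' ↑ˡ (q + r + q)) ⟩

record InducedEmb (H G : Graph) : Set where
  field
    map      : Fin (n H) → Fin (n G)
    injective : ∀ i j → map i ≡ map j → i ≡ j
    preserves : ∀ i j → adj G (map i) (map j) ≡ adj H i j
open InducedEmb public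

ContainsInduced : Graph → Graph → Set
ContainsInduced G H = InducedEmb H G

-- A copy of (Ĥ, ŝ, t̂) in G: an induced embedding; its roots are the images of ŝ, t̂.
Copy : TwoRooted → Graph → Set
Copy T G = InducedEmb (graph T) G

InCopy : ∀ T G → Copy T G → Fin (n G) → Set
InCopy T G c v = ∃ λ x → map c x ≡ v

-- An extension (H', s', t') of the copy c: s' ≠ t', both outside V(H),
-- and s (resp. t) is the unique neighbour of s' (resp. t') in H' = G[V(H) ∪ {s',t'}].
-- (In particular s' and t' are non-adjacent.)
record Extension (T : TwoRooted) (G : Graph) (c : Copy T G) : Set where
  field
    s' t'   : Fin (n G)
    s'≢t'   : s' ≢ t'
    s'∉     : ¬ InCopy T G c s'
    t'∉     : ¬ InCopy T G c t'
    s's-adj : adj G s' (map c (root₁ T)) ≡ true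
    t't-adj : adj G t' (map c (root₂ T)) ≡ true
    s'-only : ∀ x → x ≢ root₁ T → adj G s' (map c x) ≡ false
    t'-only : ∀ x → x ≢ root₂ T → adj G t' (map c x) ≡ false
    s't'-nonadj : adj G s' t' ≡ false
open Extension public

Consecutive : ∀ {k} → Fin k → Fin k → Set
Consecutive i j = (suc (toℕ i) ≡ toℕ j) ⊎ (suc (toℕ j) ≡ toℕ i)

record InducedPath (G : Graph) (u v : Fin (n G)) : Set where
  field
    len      : ℕ
    vert     : Fin (suc len) → Fin (n G)
    start    : vert Fin.zero ≡ u
    end      : vert (fromℕ len) ≡ v
    distinct : ∀ i j → vert i ≡ vert j → i ≡ j
    adj-iff₁ : ∀ i j → Consecutive i j → adj G (vert i) (vert j) ≡ true
    adj-iff₂ : ∀ i j → adj G (vert i) (vert j) ≡ true → Consecutive i j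
open InducedPath public

InClosedNbhd : ∀ T G → Copy T G → Fin (n G) → Set
InClosedNbhd T G c v = ∃ λ x → (map c x ≡ v) ⊎ (adj G v (map c x) ≡ true)

Internal : ∀ {k} → Fin (suc k) → Set
Internal {k} i = (0 < toℕ i) × (toℕ i < k)

Closable : ∀ T G (c : Copy T G) → Extension T G c → Set
Closable T G c e =
  Σ (InducedPath G (s' e) (t' e)) λ P →
    ∀ i → Internal {len P} i → ¬ InClosedNbhd T G c (vert P i)

Avoidable : ∀ T G → Copy T G → Set
Avoidable T G c = ∀ (e : Extension T G c) → Closable T G c e

Confines : Graph → TwoRooted → Set
Confines G T = ContainsInduced G (graph T) × ¬ (Σ (Copy T G) (Avoidable T G))

module Submission where

-- A copy of T with vertex map f is refuted by an extension (s', t') together with a set S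
-- of vertices that contains s', is closed under neighbours outside N[V(H)], and contains no
-- neighbour of t': every s'–t' path with interior outside N[V(H)] would have to leave S
-- just before reaching t'.  For the Petersen graph such a certificate, with S the set of
-- vertices reachable from s' outside N[V(H)], is found by exhaustive search over all maps.

open import Defs
open import Data.Bool using (true; false; _∧_)
open import Data.Bool.Properties using () renaming (_≟_ to _≟ᵇ_)
open import Data.Fin using (Fin; zero; suc; toℕ; fromℕ; inject₁; _≟_; #_)
open import Data.Fin.Induction using (<-weakInduction)
open import Data.Fin.Properties using (toℕ-inject₁; toℕ-fromℕ; any?; all?)
open import Data.Fin.Subset using (Subset; _∈_; _∪_; ⁅_⁆)
open import Data.Fin.Subset.Properties using (_∈?_)
open import Data.Nat using (ℕ; zero; suc; _<_; z<s)
open import Data.Nat.Properties using (<-trans; n<1+n)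
open import Data.Product using (∃; ∃₂; _×_; _,_; proj₁; proj₂)
open import Data.Sum using (_⊎_; inj₁)
import Data.Sum as Sum
open import Data.Vec using (Vec; []; _∷_; tabulate; lookup)
open import Data.Vec.Properties using (lookup∘tabulate)
open import Function using (_∘_)
open import Relation.Nullary using (¬_; Dec; does; contradiction)
open import Relation.Nullary.Decidable using (map′; True; toWitness; ¬?; _×-dec_; _→-dec_; _⊎-dec_)
open import Relation.Binary.PropositionalEquality using (_≡_; _≢_; _≗_; sym; trans; cong; cong₂; subst)
open import Relation.Unary using (Pred; Decidable; _⊆_)
open import Level using (0ℓ)

module _ (G : Graph) where

  Vertex : Set
  Vertex = Fin (n G)

  record Separates (R S : Pred Vertex _) (a b : Vertex) : Set where
    field
      source : S a
      closed : ∀ {u v} → S u → R v → adj G u v ≡ true → S v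
      avoids : ∀ {u} → S u → adj G u b ≡ false

  separates? : ∀ {R S : Pred Vertex _} → (∀ v → Dec (R v)) → (∀ v → Dec (S v)) →
               ∀ a b → Dec (Separates R S a b)
  separates? R? S? a b =
    map′ (λ (s , c , av) → record { source = s ; closed = c _ _ ; avoids = av _ })
         (λ sep → let open Separates sep in source , (λ _ _ → closed) , (λ _ → avoids))
         (S? a ×-dec
          all? (λ u → all? λ v → S? u →-dec R? v →-dec adj G u v ≟ᵇ true →-dec S? v) ×-dec
          all? (λ u → S? u →-dec adj G u b ≟ᵇ false))

  separates-mono : ∀ {R R′ S a b} → R′ ⊆ R → Separates R S a b → Separates R′ S a b
  separates-mono R′⊆R sep = record
    { source = source ; closed = λ su r′v → closed su (R′⊆R r′v) ; avoids = avoids }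
    where open Separates sep

  separates⇒¬walk : ∀ {R S a b} → Separates R S a b → a ≢ b →
                    ∀ L (w : Fin (suc L) → Vertex) → w zero ≡ a → w (fromℕ L) ≡ b →
                    (∀ i j → Consecutive i j → adj G (w i) (w j) ≡ true) →
                    ¬ (∀ i → Internal {L} i → R (w i))
  separates⇒¬walk sep a≢b zero w start end _ _ = a≢b (trans (sym start) end)
  separates⇒¬walk {S = S} {b = b} sep a≢b (suc L) w start end edge inR =
    contradiction (trans (sym lastEdge) (avoids (nonFinal _ last<L))) λ ()
    where
    open Separates sep
    step : ∀ i → adj G (w (inject₁ i)) (w (suc i)) ≡ true
    step i = edge _ _ (inj₁ (cong suc (toℕ-inject₁ i)))
    nonFinal : ∀ i → toℕ i < suc L → S (w i)
    nonFinal = <-weakInduction (λ i → toℕ i < suc L → S (w i))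
      (λ _ → subst S (sym start) source)
      (λ i ih i+1<L → closed (ih (subst (_< suc L) (sym (toℕ-inject₁ i)) (<-trans (n<1+n _) i+1<L)))
                             (inR (suc i) (z<s , i+1<L)) (step i))
    last<L : toℕ (inject₁ (fromℕ L)) < suc L
    last<L = subst (_< suc L) (sym (trans (toℕ-inject₁ (fromℕ L)) (toℕ-fromℕ L))) (n<1+n L)
    lastEdge : adj G (w (inject₁ (fromℕ L))) b ≡ true
    lastEdge = subst (λ x → adj G _ x ≡ true) end (step (fromℕ L))

module _ (G : Graph) {k : ℕ} (f : Fin k → Vertex G) where

  -- For f = map c this is definitionally ¬ InClosedNbhd T G c.
  Outside : Pred (Vertex G) _
  Outside v = ¬ ∃ λ x → (f x ≡ v) ⊎ (adj G v (f x) ≡ true)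

  outside? : ∀ v → Dec (Outside v)
  outside? v = ¬? (any? λ x → f x ≟ v ⊎-dec adj G v (f x) ≟ᵇ true)

  IsExtension : (r₁ r₂ : Fin k) (a b : Vertex G) → Set
  IsExtension r₁ r₂ a b =
    a ≢ b × (∀ x → f x ≢ a) × (∀ x → f x ≢ b) ×
    adj G a (f r₁) ≡ true × adj G b (f r₂) ≡ true ×
    (∀ x → x ≢ r₁ → adj G a (f x) ≡ false) × (∀ x → x ≢ r₂ → adj G b (f x) ≡ false) ×
    adj G a b ≡ false

  isExtension? : ∀ r₁ r₂ a b → Dec (IsExtension r₁ r₂ a b)
  isExtension? r₁ r₂ a b =
    ¬? (a ≟ b) ×-dec all? (λ x → ¬? (f x ≟ a)) ×-dec all? (λ x → ¬? (f x ≟ b)) ×-dec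
    adj G a (f r₁) ≟ᵇ true ×-dec adj G b (f r₂) ≟ᵇ true ×-dec
    all? (λ x → ¬? (x ≟ r₁) →-dec adj G a (f x) ≟ᵇ false) ×-dec
    all? (λ x → ¬? (x ≟ r₂) →-dec adj G b (f x) ≟ᵇ false) ×-dec
    adj G a b ≟ᵇ false

  Obstruction : (r₁ r₂ : Fin k) → Set
  Obstruction r₁ r₂ =
    ∃₂ λ a b → IsExtension r₁ r₂ a b × ∃ λ (S : Subset (n G)) → Separates G Outside (_∈ S) a b

  -- The reached set is only a candidate separator; reachObstruction? verifies it.
  grow : Subset (n G) → Subset (n G)
  grow S = S ∪ tabulate (λ v → does (outside? v) ∧ does (any? λ u → u ∈? S ×-dec adj G u v ≟ᵇ true))

  reachedWithin : ℕ → Vertex G → Subset (n G)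
  reachedWithin zero a = ⁅ a ⁆
  reachedWithin (suc d) a = grow (reachedWithin d a)

  ReachObstruction : (r₁ r₂ : Fin k) → Set
  ReachObstruction r₁ r₂ =
    ∃₂ λ a b → IsExtension r₁ r₂ a b × Separates G Outside (_∈ reachedWithin (n G) a) a b

  reachObstruction? : ∀ r₁ r₂ → Dec (ReachObstruction r₁ r₂)
  reachObstruction? r₁ r₂ = any? λ a → obstructionFrom a (reachedWithin (n G) a)
    where
    obstructionFrom : ∀ a S → Dec (∃ λ b → IsExtension r₁ r₂ a b × Separates G Outside (_∈ S) a b)
    obstructionFrom a S = any? λ b → isExtension? r₁ r₂ a b ×-dec separates? G outside? (_∈? S) a b

  reachObstruction⇒obstruction : ∀ {r₁ r₂} → ReachObstruction r₁ r₂ → Obstruction r₁ r₂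
  reachObstruction⇒obstruction (a , b , ext , sep) = a , b , ext , _ , sep

-- Maps are enumerated as vectors: a function on Fin k cannot be rebuilt from its values
-- up to ≡ without function extensionality.
all-vectors? : ∀ {m} k {P : Pred (Vec (Fin m) k) 0ℓ} → Decidable P → Dec (∀ v → P v)
all-vectors? zero P? = map′ (λ { p [] → p }) (λ h → h []) (P? [])
all-vectors? (suc k) P? =
  map′ (λ { h (x ∷ xs) → h x xs }) (λ h x xs → h (x ∷ xs)) (all? λ x → all-vectors? k (P? ∘ (x ∷_)))

module _ (H G : Graph) where

  -- Adjacency is tested first: it rejects most of the enumerated maps after one pair.
  IsEmbedding : (Fin (n H) → Vertex G) → Set
  IsEmbedding f = (∀ i j → adj G (f i) (f j) ≡ adj H i j) × (∀ i j → f i ≡ f j → i ≡ j)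

  isEmbedding? : ∀ f → Dec (IsEmbedding f)
  isEmbedding? f = all? (λ i → all? λ j → adj G (f i) (f j) ≟ᵇ adj H i j) ×-dec
                   all? (λ i → all? λ j → f i ≟ f j →-dec i ≟ j)

module _ (G : Graph) {k : ℕ} {f g : Fin k → Vertex G} (f≗g : f ≗ g) where

  outside-resp : Outside G g ⊆ Outside G f
  outside-resp out (x , h) =
    out (x , Sum.map (trans (sym (f≗g x))) (subst (λ y → adj G _ y ≡ true) (f≗g x)) h)

  isExtension-resp : ∀ {r₁ r₂ a b} → IsExtension G f r₁ r₂ a b → IsExtension G g r₁ r₂ a b
  isExtension-resp {r₁} {r₂} {a} {b} (a≢b , a∉ , b∉ , a~r₁ , b~r₂ , a≁ , b≁ , a≁b) =
    a≢b , (λ x → a∉ x ∘ trans (f≗g x)) , (λ x → b∉ x ∘ trans (f≗g x)) ,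
    trans (sym (adj-resp a r₁)) a~r₁ , trans (sym (adj-resp b r₂)) b~r₂ ,
    (λ x x≢r₁ → trans (sym (adj-resp a x)) (a≁ x x≢r₁)) ,
    (λ x x≢r₂ → trans (sym (adj-resp b x)) (b≁ x x≢r₂)) , a≁b
    where
    adj-resp : ∀ u x → adj G u (f x) ≡ adj G u (g x)
    adj-resp u x = cong (adj G u) (f≗g x)

  obstruction-resp : ∀ {r₁ r₂} → Obstruction G f r₁ r₂ → Obstruction G g r₁ r₂
  obstruction-resp (a , b , ext , S , sep) =
    a , b , isExtension-resp ext , S , separates-mono G outside-resp sep

module _ {H G : Graph} {f g : Fin (n H) → Vertex G} (f≗g : f ≗ g) where

  isEmbedding-resp : IsEmbedding H G f → IsEmbedding H G g
  isEmbedding-resp (pres , inj) =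
    (λ i j → trans (sym (cong₂ (adj G) (f≗g i) (f≗g j))) (pres i j)) ,
    (λ i j e → inj i j (trans (f≗g i) (trans e (sym (f≗g j)))))

module _ {T : TwoRooted} {G : Graph} where

  obstruction⇒¬avoidable : (c : Copy T G) → Obstruction G (map c) (root₁ T) (root₂ T) →
                           ¬ Avoidable T G c
  obstruction⇒¬avoidable c (a , b , (a≢b , a∉ , b∉ , a~s , b~t , a≁ , b≁ , a≁b) , _ , sep) avoidable =
    separates⇒¬walk G sep a≢b (len P) (vert P) (start P) (end P) (adj-iff₁ P) interior-outside
    where
    extension : Extension T G c
    extension = record
      { s' = a ; t' = b ; s'≢t' = a≢b
      ; s'∉ = λ (x , e) → a∉ x e ; t'∉ = λ (x , e) → b∉ x e
      ; s's-adj = a~s ; t't-adj = b~t ; s'-only = a≁ ; t'-only = b≁ ; s't'-nonadj = a≁b }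
    P = proj₁ (avoidable extension)
    interior-outside = proj₂ (avoidable extension)

  everyCopyObstructed? : Dec (∀ v → IsEmbedding (graph T) G (lookup v) →
                                   ReachObstruction G (lookup v) (root₁ T) (root₂ T))
  everyCopyObstructed? = all-vectors? _ λ v →
    isEmbedding? (graph T) G (lookup v) →-dec reachObstruction? G (lookup v) (root₁ T) (root₂ T)

  confines : (witness : Vec (Vertex G) (n (graph T))) →
             True (isEmbedding? (graph T) G (lookup witness)) → True everyCopyObstructed? →
             Confines G T
  confines witness isEmb obstructed = embedding , noAvoidableCopy
    where
    embedding : ContainsInduced G (graph T)
    embedding = record { map = lookup witness
                       ; injective = proj₂ (toWitness isEmb) ; preserves = proj₁ (toWitness isEmb) }
    noAvoidableCopy : ¬ ∃ (Avoidable T G)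
    noAvoidableCopy (c , avoidable) = obstruction⇒¬avoidable c obstruction avoidable
      where
      tabulated≗map : lookup (tabulate (map c)) ≗ map c
      tabulated≗map = lookup∘tabulate (map c)
      tabulatedIsEmbedding : IsEmbedding (graph T) G (lookup (tabulate (map c)))
      tabulatedIsEmbedding =
        isEmbedding-resp {graph T} {G} (sym ∘ tabulated≗map) (preserves c , injective c)
      obstruction : Obstruction G (map c) (root₁ T) (root₂ T)
      obstruction = obstruction-resp G tabulated≗map
        (reachObstruction⇒obstruction G _ (toWitness obstructed (tabulate (map c)) tabulatedIsEmbedding))

proposition4p4 : Confines Petersen (T₁ 0 0 2) × Confines Petersen (T₁ 1 0 2) × Confines Petersen (T₁ 0 1 1)
proposition4p4 = confines (# 0 ∷ # 1 ∷ # 2 ∷ []) _ _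
               , confines (# 0 ∷ # 1 ∷ # 2 ∷ # 3 ∷ []) _ _
               , confines (# 0 ∷ # 1 ∷ # 2 ∷ # 6 ∷ []) _ _
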